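{- Let $u$ be an $m\times n$ matrix with entries in $\{0,1\}$, viewed as a two-player zero-sum game, and let $u'$ be a (nonempty) row submatrix of $u$. If $u'$ is balanced and $\mathrm{rowmax}(u)=\mathrm{rowmax}(u')$, then (1) $\mathscr{V}(u)=\mathscr{V}(u')$; and (2) the strategy profile $(\bar{\mu},\bar{\nu})$ is an equilibrium in $u$, where $\bar{\mu}$ is Eloise's mixed strategy in $u$ that assigns equal probability to each row of $u$ belonging to $u'$ and probability $0$ to all other rows, and $\bar{\nu}$ is Abelard's uniform mixed strategy on the $n$ columns.
   Context: A game is an $m\times n$ matrix $u$ with entries in $\{0,1\}$; Eloise chooses a row $i$, Abelard a column $j$, Eloise receives $u(i,j)$ and Abelard $1-u(i,j)$. Mixed strategies $\mu$ (rows) and $\nu$ (columns) are probability distributions; $U(\mu,\nu)=\sum_{i,j}\mu(i)\nu(j)u(i,j)$. $\mathscr{V}(u)=\max_\mu\min_\nu U(\mu,\nu)$. A profile $(\mu,\nu)$ is an equilibrium if $U(\mu',\nu)\le U(\mu,\nu)\le U(\mu,\nu')$ for all mixed strategies $\mu',\nu'$. A row submatrix of $u$ is obtained by deleting some rows of $u$. A matrix is balanced if all its row sums are equal and all its column sums are equal. $\mathrm{rowmax}(w)$ is the maximum row sum of the matrix $w$.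
   Formalization: The mixed strategies $\mu$, $\nu$, including the deviations $\mu',\nu'$, assign rational probabilities to the rows and columns. -}

module Defs where

open import Data.Bool using (Bool; true; false)
open import Data.Nat as ℕ using (ℕ; zero; suc)
open import Data.Fin as Fin using (Fin)
open import Data.Fin.Properties using (any?)
open import Data.Integer using (+_)
open import Data.Rational using (ℚ; 0ℚ; 1ℚ; _+_; _*_; _≤_; _/_)
open import Data.Product using (Σ; _×_; _,_)
open import Relation.Binary.PropositionalEquality using (_≡_)
open import Relation.Nullary using (yes; no)

-- A game: an m×n matrix with entries in {0,1} (true = 1, false = 0).
Game : ℕ → ℕ → Set
Game m n = Fin m → Fin n → Bool

bit : Bool → ℚ
bit true  = 1ℚ
bit false = 0ℚ

bitℕ : Bool → ℕ
bitℕ true  = 1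
bitℕ false = 0

Σℚ : ∀ {n} → (Fin n → ℚ) → ℚ
Σℚ {zero}  f = 0ℚ
Σℚ {suc n} f = f Fin.zero + Σℚ (λ i → f (Fin.suc i))

Σℕ : ∀ {n} → (Fin n → ℕ) → ℕ
Σℕ {zero}  f = 0
Σℕ {suc n} f = f Fin.zero ℕ.+ Σℕ (λ i → f (Fin.suc i))

IsMixed : ∀ {k} → (Fin k → ℚ) → Set
IsMixed {k} μ = ((i : Fin k) → 0ℚ ≤ μ i) × Σℚ μ ≡ 1ℚ

U : ∀ {m n} → Game m n → (Fin m → ℚ) → (Fin n → ℚ) → ℚ
U u μ ν = Σℚ (λ i → Σℚ (λ j → (μ i * ν j) * bit (u i j)))

-- v = max_μ min_ν U(μ,ν)  (maximum attained; minimum over ν)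
IsValue : ∀ {m n} → Game m n → ℚ → Set
IsValue {m} {n} u v =
  Σ (Fin m → ℚ) (λ μ → IsMixed μ × ((ν : Fin n → ℚ) → IsMixed ν → v ≤ U u μ ν))
  × ((μ : Fin m → ℚ) → IsMixed μ →
       Σ (Fin n → ℚ) (λ ν → IsMixed ν × U u μ ν ≤ v))

IsEquilibrium : ∀ {m n} → Game m n → (Fin m → ℚ) → (Fin n → ℚ) → Set
IsEquilibrium {m} {n} u μ ν =
  IsMixed μ × IsMixed ν
  × ((μ' : Fin m → ℚ) → IsMixed μ' → U u μ' ν ≤ U u μ ν)
  × ((ν' : Fin n → ℚ) → IsMixed ν' → U u μ ν ≤ U u μ ν')

-- row submatrix: keep the rows σ 0 < σ 1 < ... < σ (k-1)
StrictlyIncreasing : ∀ {k m} → (Fin k → Fin m) → Set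
StrictlyIncreasing σ = ∀ r s → r Fin.< s → σ r Fin.< σ s

subrows : ∀ {k m n} → Game m n → (Fin k → Fin m) → Game k n
subrows u σ r j = u (σ r) j

rowSum : ∀ {m n} → Game m n → Fin m → ℕ
rowSum u i = Σℕ (λ j → bitℕ (u i j))

colSum : ∀ {m n} → Game m n → Fin n → ℕ
colSum u j = Σℕ (λ i → bitℕ (u i j))

Balanced : ∀ {m n} → Game m n → Set
Balanced u = (∀ i i' → rowSum u i ≡ rowSum u i') × (∀ j j' → colSum u j ≡ colSum u j')

maxℕ : ∀ {m} → (Fin m → ℕ) → ℕ
maxℕ {zero}  f = 0
maxℕ {suc m} f = f Fin.zero ℕ.⊔ maxℕ (λ i → f (Fin.suc i))

rowmax : ∀ {m n} → Game m n → ℕ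
rowmax u = maxℕ (rowSum u)

muBar : ∀ {k m} .{{_ : ℕ.NonZero k}} → (Fin k → Fin m) → Fin m → ℚ
muBar {k} σ i with any? (λ r → σ r Fin.≟ i)
... | yes _ = + 1 / k
... | no  _ = 0ℚ

nuBar : ∀ {n} .{{_ : ℕ.NonZero n}} → Fin n → ℚ
nuBar {n} _ = + 1 / n

-- Let u′ have k rows, n columns, common row sum R and common column sum C.
-- Against the uniform ν̄ a row i of u pays rowSum u i / n ≤ R/n, since
-- rowmax u = rowmax u′ = R.  The strategy μ̄ plays the rows of u′ uniformly,
-- so against every column it pays C/k.  Counting the ones of u′ gives
-- kR = nC, hence C/k = R/n, and (μ̄, ν̄) is a saddle point of value R/n in u,
-- as is (uniform, ν̄) in u′.
module Submission where

open import Defs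
open import Data.Nat using (ℕ; NonZero)
open import Data.Fin using (Fin)
open import Data.Rational using (ℚ)
open import Data.Product using (Σ; _×_)
open import Relation.Binary.PropositionalEquality using (_≡_)

open import Algebra.Bundles using (CommutativeRing)
open import Data.Bool using (Bool; true; false)
open import Data.Empty using (⊥-elim)
open import Data.Fin using (zero; suc; _≟_)
open import Data.Fin.Properties using (any?; <-cmp; <-irrefl)
open import Data.Integer as ℤ using (+_)
import Data.Integer.Properties as ℤ
open import Data.Nat as ℕ using (_≤_)
open import Data.Nat.Coprimality using (1-coprimeTo)
import Data.Nat.Properties as ℕ
open import Data.Product using (_,_; proj₁; proj₂)
open import Data.Rational using (0ℚ; 1ℚ; _+_; _*_; _/_; nonNegative)
  renaming (_≤_ to _≤ℚ_)
open import Data.Rational.Literals using (fromℤ)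
open import Data.Rational.Properties
  using ( /-cong; ↥p/↧p≡p; normalize-coprime; normalize-nonNeg; nonNegative⁻¹; +-*-commutativeRing
        ; +-identityˡ; +-identityʳ; +-mono-≤; +-monoʳ-≤
        ; *-identityˡ; *-identityʳ; *-zeroˡ; *-zeroʳ; *-assoc; *-comm; *-distribʳ-+; *-inverseʳ
        ; *-monoˡ-≤-nonNeg; *-monoʳ-≤-nonNeg; ≤-refl; ≤-reflexive; ≤-trans; ≤-antisym )
open import Function.Definitions using (Injective)
open import Relation.Binary using (tri<; tri≈; tri>)
open import Relation.Binary.PropositionalEquality
  using (refl; sym; trans; cong; cong₂; subst; subst₂; module ≡-Reasoning)
open import Relation.Nullary using (yes; no; ¬_)

open import Algebra.Properties.Semiring.Sum (CommutativeRing.semiring +-*-commutativeRing)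
  using (sum; sum-syntax; sum-cong-≗; sum-replicate-zero; ∑-comm; *-distribˡ-sum; *-distribʳ-sum)

open ≡-Reasoning

fromℕ : ℕ → ℚ
fromℕ n = fromℤ (+ n)

fromℕ-+ : ∀ a b → fromℕ (a ℕ.+ b) ≡ fromℕ a + fromℕ b
fromℕ-+ a b = sym (begin
  fromℕ a + fromℕ b  ≡⟨ /-cong numerator refl ⟩
  + (a ℕ.+ b) / 1    ≡⟨ ↥p/↧p≡p (fromℕ (a ℕ.+ b)) ⟩
  fromℕ (a ℕ.+ b)    ∎)
  where
  numerator : + a ℤ.* + 1 ℤ.+ + b ℤ.* + 1 ≡ + (a ℕ.+ b)
  numerator = trans (cong₂ ℤ._+_ (ℤ.*-identityʳ (+ a)) (ℤ.*-identityʳ (+ b))) (sym (ℤ.pos-+ a b))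

fromℕ-nonNeg : ∀ n → 0ℚ ≤ℚ fromℕ n
fromℕ-nonNeg n = nonNegative⁻¹ (fromℕ n)

fromℕ-mono-≤ : ∀ {a b} → a ≤ b → fromℕ a ≤ℚ fromℕ b
fromℕ-mono-≤ {a} {b} a≤b = subst₂ _≤ℚ_ (+-identityʳ (fromℕ a))
  (trans (sym (fromℕ-+ a (b ℕ.∸ a))) (cong fromℕ (ℕ.m+[n∸m]≡n a≤b)))
  (+-monoʳ-≤ (fromℕ a) (fromℕ-nonNeg (b ℕ.∸ a)))

fromℕ-*-inverse : ∀ n .{{_ : NonZero n}} → fromℕ n * (+ 1 / n) ≡ 1ℚ
fromℕ-*-inverse (ℕ.suc k)
  rewrite normalize-coprime {1} {k} (1-coprimeTo (ℕ.suc k)) = *-inverseʳ (fromℕ (ℕ.suc k))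

1/n-nonNeg : ∀ n .{{_ : NonZero n}} → 0ℚ ≤ℚ + 1 / n
1/n-nonNeg n = nonNegative⁻¹ (+ 1 / n) {{normalize-nonNeg 1 n}}

bit≡fromℕ-bitℕ : ∀ b → bit b ≡ fromℕ (bitℕ b)
bit≡fromℕ-bitℕ true  = refl
bit≡fromℕ-bitℕ false = refl

Σℚ≡sum : ∀ {n} (f : Fin n → ℚ) → Σℚ f ≡ sum f
Σℚ≡sum {ℕ.zero}  f = refl
Σℚ≡sum {ℕ.suc n} f = cong (_+_ (f zero)) (Σℚ≡sum (λ i → f (suc i)))

sum-mono-≤ : ∀ {n} {f g : Fin n → ℚ} → (∀ i → f i ≤ℚ g i) → sum f ≤ℚ sum g
sum-mono-≤ {ℕ.zero}  f≤g = ≤-refl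
sum-mono-≤ {ℕ.suc n} f≤g = +-mono-≤ (f≤g zero) (sum-mono-≤ (λ i → f≤g (suc i)))

sum-const : ∀ n x → ∑[ i < n ] x ≡ fromℕ n * x
sum-const ℕ.zero    x = sym (*-zeroˡ x)
sum-const (ℕ.suc n) x = begin
  x + ∑[ i < n ] x          ≡⟨ cong₂ _+_ (sym (*-identityˡ x)) (sum-const n x) ⟩
  1ℚ * x + fromℕ n * x      ≡⟨ sym (*-distribʳ-+ x 1ℚ (fromℕ n)) ⟩
  (1ℚ + fromℕ n) * x        ≡⟨ cong (_* x) (sym (fromℕ-+ 1 n)) ⟩
  fromℕ (ℕ.suc n) * x       ∎

sum-fromℕ : ∀ {n} (f : Fin n → ℕ) → ∑[ i < n ] fromℕ (f i) ≡ fromℕ (Σℕ f)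
sum-fromℕ {ℕ.zero}  f = refl
sum-fromℕ {ℕ.suc n} f = trans (cong (_+_ (fromℕ (f zero))) (sum-fromℕ (λ i → f (suc i))))
  (sym (fromℕ-+ (f zero) (Σℕ (λ i → f (suc i)))))

module _ {n} {μ : Fin n → ℚ} (mixed : IsMixed μ) where

  expectation-const : ∀ x → ∑[ i < n ] (μ i * x) ≡ x
  expectation-const x = begin
    ∑[ i < n ] (μ i * x)  ≡⟨ *-distribʳ-sum x μ ⟨
    sum μ * x             ≡⟨ cong (_* x) (trans (sym (Σℚ≡sum μ)) (proj₂ mixed)) ⟩
    1ℚ * x                ≡⟨ *-identityˡ x ⟩
    x                     ∎

  expectation-≤ : ∀ {f : Fin n → ℚ} {x} → (∀ i → f i ≤ℚ x) → ∑[ i < n ] (μ i * f i) ≤ℚ x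
  expectation-≤ {f} {x} f≤x = ≤-trans
    (sum-mono-≤ (λ i → *-monoˡ-≤-nonNeg (μ i) {{nonNegative (proj₁ mixed i)}} (f≤x i)))
    (≤-reflexive (expectation-const x))

nuBar-isMixed : ∀ {n} .{{_ : NonZero n}} → IsMixed {n} nuBar
nuBar-isMixed {n} = (λ _ → 1/n-nonNeg n)
  , trans (Σℚ≡sum nuBar) (trans (sum-const n (+ 1 / n)) (fromℕ-*-inverse n))

module _ {m n} (w : Game m n) (μ : Fin m → ℚ) (ν : Fin n → ℚ) where

  U≡∑∑ : U w μ ν ≡ ∑[ i < m ] ∑[ j < n ] (μ i * ν j * bit (w i j))
  U≡∑∑ = trans (Σℚ≡sum (λ i → Σℚ (λ j → μ i * ν j * bit (w i j))))
    (sum-cong-≗ (λ i → Σℚ≡sum (λ j → μ i * ν j * bit (w i j))))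

  U-byRows : U w μ ν ≡ ∑[ i < m ] (μ i * ∑[ j < n ] (ν j * bit (w i j)))
  U-byRows = trans U≡∑∑ (sum-cong-≗ λ i → begin
    ∑[ j < n ] (μ i * ν j * bit (w i j))   ≡⟨ sum-cong-≗ (λ j → *-assoc (μ i) (ν j) _) ⟩
    ∑[ j < n ] (μ i * (ν j * bit (w i j))) ≡⟨ *-distribˡ-sum (μ i) (λ j → ν j * bit (w i j)) ⟨
    μ i * ∑[ j < n ] (ν j * bit (w i j))   ∎)

  U-byColumns : U w μ ν ≡ ∑[ j < n ] (ν j * ∑[ i < m ] (μ i * bit (w i j)))
  U-byColumns = trans U≡∑∑ (trans (∑-comm (λ i j → μ i * ν j * bit (w i j))) (sum-cong-≗ λ j → begin
    ∑[ i < m ] (μ i * ν j * bit (w i j))   ≡⟨ sum-cong-≗ (λ i → reassoc (μ i) (ν j) _) ⟩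
    ∑[ i < m ] (ν j * (μ i * bit (w i j))) ≡⟨ *-distribˡ-sum (ν j) (λ i → μ i * bit (w i j)) ⟨
    ν j * ∑[ i < m ] (μ i * bit (w i j))   ∎))
    where
    reassoc : ∀ a b c → (a * b) * c ≡ b * (a * c)
    reassoc a b c = trans (cong (_* c) (*-comm a b)) (*-assoc b a c)

sum-nuBar-bit : ∀ {n} .{{_ : NonZero n}} (f : Fin n → Bool) →
  ∑[ j < n ] (nuBar j * bit (f j)) ≡ fromℕ (Σℕ (λ j → bitℕ (f j))) * (+ 1 / n)
sum-nuBar-bit {n} f = begin
  ∑[ j < n ] (nuBar j * bit (f j))     ≡⟨ *-distribˡ-sum (+ 1 / n) (λ j → bit (f j)) ⟨
  (+ 1 / n) * ∑[ j < n ] bit (f j)      ≡⟨ cong ((+ 1 / n) *_) (sum-cong-≗ (λ j → bit≡fromℕ-bitℕ (f j))) ⟩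
  (+ 1 / n) * ∑[ j < n ] fromℕ (bitℕ (f j)) ≡⟨ cong ((+ 1 / n) *_) (sum-fromℕ (λ j → bitℕ (f j))) ⟩
  (+ 1 / n) * fromℕ (Σℕ (λ j → bitℕ (f j))) ≡⟨ *-comm (+ 1 / n) _ ⟩
  fromℕ (Σℕ (λ j → bitℕ (f j))) * (+ 1 / n) ∎

module _ {m n} .{{_ : NonZero n}} (w : Game m n) {μ : Fin m → ℚ} (mixed : IsMixed μ) where

  U-nuBarʳ : U w μ nuBar ≡ ∑[ i < m ] (μ i * (fromℕ (rowSum w i) * (+ 1 / n)))
  U-nuBarʳ = trans (U-byRows w μ nuBar) (sum-cong-≗ (λ i → cong (μ i *_) (sum-nuBar-bit (w i))))

  U-nuBarʳ-≤ : ∀ {R} → (∀ i → rowSum w i ≤ R) → U w μ nuBar ≤ℚ fromℕ R * (+ 1 / n)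
  U-nuBarʳ-≤ rows≤R = ≤-trans (≤-reflexive U-nuBarʳ) (expectation-≤ mixed (λ i →
    *-monoʳ-≤-nonNeg (+ 1 / n) {{normalize-nonNeg 1 n}} (fromℕ-mono-≤ (rows≤R i))))

  U-nuBarʳ-≡ : ∀ {R} → (∀ i → rowSum w i ≡ R) → U w μ nuBar ≡ fromℕ R * (+ 1 / n)
  U-nuBarʳ-≡ {R} rows≡R = trans U-nuBarʳ (trans
    (sum-cong-≗ (λ i → cong (λ s → μ i * (fromℕ s * (+ 1 / n))) (rows≡R i)))
    (expectation-const mixed (fromℕ R * (+ 1 / n))))

U-nuBarˡ-≡ : ∀ {m n} .{{_ : NonZero m}} (w : Game m n) {ν : Fin n → ℚ} → IsMixed ν →
  ∀ {C} → (∀ j → colSum w j ≡ C) → U w nuBar ν ≡ fromℕ C * (+ 1 / m)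
U-nuBarˡ-≡ {m} {n} w {ν} mixed {C} cols≡C = begin
  U w nuBar ν                                                ≡⟨ U-byColumns w nuBar ν ⟩
  ∑[ j < n ] (ν j * ∑[ i < m ] (nuBar i * bit (w i j)))      ≡⟨ sum-cong-≗ (λ j → cong (ν j *_) (column j)) ⟩
  ∑[ j < n ] (ν j * (fromℕ C * (+ 1 / m)))                   ≡⟨ expectation-const mixed _ ⟩
  fromℕ C * (+ 1 / m)                                        ∎
  where
  column : ∀ j → ∑[ i < m ] (nuBar i * bit (w i j)) ≡ fromℕ C * (+ 1 / m)
  column j = trans (sum-nuBar-bit (λ i → w i j)) (cong (λ s → fromℕ s * (+ 1 / m)) (cols≡C j))

-- Computing U w ν̄ ν̄ once by columns and once by rows shows C/k = R/n.
U-nuBarˡ-balanced : ∀ {k n} (w : Game (ℕ.suc k) (ℕ.suc n)) → Balanced w →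
  ∀ {ν} → IsMixed ν → U w nuBar ν ≡ fromℕ (rowSum w zero) * (+ 1 / ℕ.suc n)
U-nuBarˡ-balanced w (rows≡ , cols≡) {ν} mixed = begin
  U w nuBar ν      ≡⟨ U-nuBarˡ-≡ w mixed (λ j → cols≡ j zero) ⟩
  _                ≡⟨ U-nuBarˡ-≡ w nuBar-isMixed (λ j → cols≡ j zero) ⟨
  U w nuBar nuBar  ≡⟨ U-nuBarʳ-≡ w nuBar-isMixed (λ i → rows≡ i zero) ⟩
  _                ∎

δ : ∀ {m} → Fin m → Fin m → ℚ
δ zero    zero    = 1ℚ
δ zero    (suc _) = 0ℚ
δ (suc _) zero    = 0ℚ
δ (suc a) (suc b) = δ a b

δ-refl : ∀ {m} (a : Fin m) → δ a a ≡ 1ℚ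
δ-refl zero    = refl
δ-refl (suc a) = δ-refl a

δ-≢ : ∀ {m} {a b : Fin m} → ¬ a ≡ b → δ a b ≡ 0ℚ
δ-≢ {a = zero}  {zero}  a≢b = ⊥-elim (a≢b refl)
δ-≢ {a = zero}  {suc b} a≢b = refl
δ-≢ {a = suc a} {zero}  a≢b = refl
δ-≢ {a = suc a} {suc b} a≢b = δ-≢ (λ a≡b → a≢b (cong suc a≡b))

δ-sym : ∀ {m} (a b : Fin m) → δ a b ≡ δ b a
δ-sym zero    zero    = refl
δ-sym zero    (suc b) = refl
δ-sym (suc a) zero    = refl
δ-sym (suc a) (suc b) = δ-sym a b

sum-δ : ∀ {m} (a : Fin m) (g : Fin m → ℚ) → ∑[ i < m ] (δ a i * g i) ≡ g a
sum-δ {ℕ.suc m} zero g = begin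
  1ℚ * g zero + ∑[ i < m ] (0ℚ * g (suc i))  ≡⟨ cong₂ _+_ (*-identityˡ (g zero)) tail≡0 ⟩
  g zero + 0ℚ                                ≡⟨ +-identityʳ (g zero) ⟩
  g zero                                     ∎
  where
  tail≡0 : ∑[ i < m ] (0ℚ * g (suc i)) ≡ 0ℚ
  tail≡0 = trans (sum-cong-≗ (λ i → *-zeroˡ (g (suc i)))) (sum-replicate-zero m)
sum-δ {ℕ.suc m} (suc a) g = trans (cong₂ _+_ (*-zeroˡ (g zero)) (sum-δ a (λ i → g (suc i))))
  (+-identityˡ (g (suc a)))

strictlyIncreasing⇒injective : ∀ {k m} {σ : Fin k → Fin m} → StrictlyIncreasing σ → Injective _≡_ _≡_ σ
strictlyIncreasing⇒injective {σ = σ} increasing {r} {s} σr≡σs with <-cmp r s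
... | tri< r<s _ _ = ⊥-elim (<-irrefl σr≡σs (increasing r s r<s))
... | tri≈ _ r≡s _ = r≡s
... | tri> _ _ s<r = ⊥-elim (<-irrefl (sym σr≡σs) (increasing s r s<r))

module _ {k m} {σ : Fin k → Fin m} (σ-injective : Injective _≡_ _≡_ σ) where

  δ-injective : ∀ r s → δ (σ r) (σ s) ≡ δ r s
  δ-injective r s with r ≟ s
  ... | yes refl = trans (δ-refl (σ r)) (sym (δ-refl r))
  ... | no r≢s   = trans (δ-≢ (λ σr≡σs → r≢s (σ-injective σr≡σs))) (sym (δ-≢ r≢s))

  module _ .{{_ : NonZero k}} where

    muBar-as-sum : ∀ i → muBar σ i ≡ ∑[ r < k ] (nuBar r * δ (σ r) i)
    muBar-as-sum i with any? (λ r → σ r ≟ i)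
    ... | yes (r₀ , refl) = sym (begin
      ∑[ r < k ] (nuBar r * δ (σ r) (σ r₀)) ≡⟨ sum-cong-≗ (λ r → trans (*-comm (nuBar r) _)
                                                  (cong (_* nuBar r) (trans (δ-injective r r₀) (δ-sym r r₀)))) ⟩
      ∑[ r < k ] (δ r₀ r * nuBar r)         ≡⟨ sum-δ r₀ nuBar ⟩
      + 1 / k                               ∎)
    ... | no ∉image = sym (trans
      (sum-cong-≗ (λ r → trans (cong (nuBar r *_) (δ-≢ (λ σr≡i → ∉image (r , σr≡i)))) (*-zeroʳ (nuBar r))))
      (sum-replicate-zero k))

    expectation-muBar : ∀ (g : Fin m → ℚ) → ∑[ i < m ] (muBar σ i * g i) ≡ ∑[ r < k ] (nuBar r * g (σ r))
    expectation-muBar g = begin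
      ∑[ i < m ] (muBar σ i * g i)
        ≡⟨ sum-cong-≗ (λ i → cong (_* g i) (muBar-as-sum i)) ⟩
      ∑[ i < m ] (∑[ r < k ] (nuBar r * δ (σ r) i) * g i)
        ≡⟨ sum-cong-≗ (λ i → *-distribʳ-sum (g i) (λ r → nuBar r * δ (σ r) i)) ⟩
      ∑[ i < m ] ∑[ r < k ] (nuBar r * δ (σ r) i * g i)
        ≡⟨ ∑-comm (λ i r → nuBar r * δ (σ r) i * g i) ⟩
      ∑[ r < k ] ∑[ i < m ] (nuBar r * δ (σ r) i * g i)
        ≡⟨ sum-cong-≗ (λ r → trans (sum-cong-≗ (λ i → *-assoc (nuBar r) (δ (σ r) i) (g i)))
                                   (sym (*-distribˡ-sum (nuBar r) (λ i → δ (σ r) i * g i)))) ⟩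
      ∑[ r < k ] (nuBar r * ∑[ i < m ] (δ (σ r) i * g i))
        ≡⟨ sum-cong-≗ (λ r → cong (nuBar r *_) (sum-δ (σ r) g)) ⟩
      ∑[ r < k ] (nuBar r * g (σ r))
        ∎

    muBar-isMixed : IsMixed (muBar σ)
    muBar-isMixed = muBar-nonNeg , (begin
      Σℚ (muBar σ)                    ≡⟨ Σℚ≡sum (muBar σ) ⟩
      ∑[ i < m ] muBar σ i            ≡⟨ sum-cong-≗ (λ i → *-identityʳ (muBar σ i)) ⟨
      ∑[ i < m ] (muBar σ i * 1ℚ)     ≡⟨ expectation-muBar (λ _ → 1ℚ) ⟩
      ∑[ r < k ] (nuBar r * 1ℚ)       ≡⟨ expectation-const nuBar-isMixed 1ℚ ⟩
      1ℚ                              ∎)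
      where
      muBar-nonNeg : ∀ i → 0ℚ ≤ℚ muBar σ i
      muBar-nonNeg i with any? (λ r → σ r ≟ i)
      ... | yes _ = 1/n-nonNeg k
      ... | no  _ = ≤-refl

    U-muBar : ∀ {n} (u : Game m n) ν → U u (muBar σ) ν ≡ U (subrows u σ) nuBar ν
    U-muBar u ν = trans (U-byRows u (muBar σ) ν)
      (trans (expectation-muBar (λ i → ∑[ j < _ ] (ν j * bit (u i j))))
             (sym (U-byRows (subrows u σ) nuBar ν)))

record IsSaddlePoint {m n} (u : Game m n) (μ : Fin m → ℚ) (ν : Fin n → ℚ) (v : ℚ) : Set where
  field
    μ-mixed   : IsMixed μ
    ν-mixed   : IsMixed ν
    μ-secures : ∀ ν′ → IsMixed ν′ → v ≤ℚ U u μ ν′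
    ν-secures : ∀ μ′ → IsMixed μ′ → U u μ′ ν ≤ℚ v

module _ {m n} {u : Game m n} {μ ν v} (saddle : IsSaddlePoint u μ ν v) where

  open IsSaddlePoint saddle

  saddlePoint⇒isValue : IsValue u v
  saddlePoint⇒isValue = (μ , μ-mixed , μ-secures) , (λ μ′ mixed → ν , ν-mixed , ν-secures μ′ mixed)

  saddlePoint⇒isEquilibrium : IsEquilibrium u μ ν
  saddlePoint⇒isEquilibrium = μ-mixed , ν-mixed
    , (λ μ′ mixed → ≤-trans (ν-secures μ′ mixed) (≤-reflexive (sym payoff≡v)))
    , (λ ν′ mixed → ≤-trans (≤-reflexive payoff≡v) (μ-secures ν′ mixed))
    where
    payoff≡v : U u μ ν ≡ v
    payoff≡v = ≤-antisym (ν-secures μ μ-mixed) (μ-secures ν ν-mixed)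

balanced⇒saddlePoint : ∀ {k n} (w : Game (ℕ.suc k) (ℕ.suc n)) → Balanced w →
  IsSaddlePoint w nuBar nuBar (fromℕ (rowSum w zero) * (+ 1 / ℕ.suc n))
balanced⇒saddlePoint w balanced = record
  { μ-mixed   = nuBar-isMixed
  ; ν-mixed   = nuBar-isMixed
  ; μ-secures = λ ν′ mixed → ≤-reflexive (sym (U-nuBarˡ-balanced w balanced mixed))
  ; ν-secures = λ μ′ mixed → U-nuBarʳ-≤ w mixed (λ r → ℕ.≤-reflexive (proj₁ balanced r zero))
  }

maxℕ-upperBound : ∀ {m} (f : Fin m → ℕ) i → f i ≤ maxℕ f
maxℕ-upperBound f zero    = ℕ.m≤m⊔n _ _
maxℕ-upperBound f (suc i) = ℕ.≤-trans (maxℕ-upperBound (λ j → f (suc j)) i) (ℕ.m≤n⊔m _ _)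

maxℕ-least : ∀ {m} (f : Fin m → ℕ) {R} → (∀ i → f i ≤ R) → maxℕ f ≤ R
maxℕ-least {ℕ.zero}  f f≤R = ℕ.z≤n
maxℕ-least {ℕ.suc m} f f≤R = ℕ.⊔-lub (f≤R zero) (maxℕ-least (λ i → f (suc i)) (λ i → f≤R (suc i)))

proposition5 : ∀ {m n k : ℕ} → ⦃ _ : NonZero n ⦄ → ⦃ _ : NonZero k ⦄
    → (u : Game m n) → (σ : Fin k → Fin m) → StrictlyIncreasing σ
    → Balanced (subrows u σ) → rowmax u ≡ rowmax (subrows u σ)
    → Σ ℚ (λ v → IsValue u v × IsValue (subrows u σ) v)
    × IsEquilibrium u (muBar σ) nuBar
proposition5 {n = ℕ.suc n₋₁} {k = ℕ.suc _} u σ increasing balanced rowmax≡ =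
  (v , saddlePoint⇒isValue saddle-u , saddlePoint⇒isValue (balanced⇒saddlePoint u′ balanced))
  , saddlePoint⇒isEquilibrium saddle-u
  where
  u′ = subrows u σ
  σ-injective = strictlyIncreasing⇒injective increasing
  R = rowSum u′ zero
  v = fromℕ R * (+ 1 / ℕ.suc n₋₁)

  rows-u≤R : ∀ i → rowSum u i ≤ R
  rows-u≤R i = ℕ.≤-trans (maxℕ-upperBound (rowSum u) i)
    (subst (_≤ R) (sym rowmax≡) (maxℕ-least (rowSum u′) (λ r → ℕ.≤-reflexive (proj₁ balanced r zero))))

  saddle-u : IsSaddlePoint u (muBar σ) nuBar v
  saddle-u = record
    { μ-mixed   = muBar-isMixed σ-injective
    ; ν-mixed   = nuBar-isMixed
    ; μ-secures = λ ν′ mixed → ≤-reflexive (sym (trans (U-muBar σ-injective u ν′)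
                                                     (U-nuBarˡ-balanced u′ balanced mixed)))
    ; ν-secures = λ μ′ mixed → U-nuBarʳ-≤ u mixed rows-u≤R
    }
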